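{- Let $\Gamma$ be a diagram with at least three vertices and let $k$ be a vertex of $\Gamma$. If $k$ lies on a non-oriented cycle or on an edge of weight greater than or equal to $4$, then $\mu_k(\Gamma)$ contains an edge of weight at least $4$ or contains a non-oriented cycle.
   Context: Skew-symmetrizable: integer square $B$ with $DB$ skew-symmetric for a diagonal $D$ with positive diagonal. Mutation at $k$: $\mu_k(B)=B'$ with $B'_{i,j}=-B_{i,j}$ if $i=k$ or $j=k$, otherwise $B'_{i,j}=B_{i,j}+\mathrm{sgn}(B_{i,k})[B_{i,k}B_{k,j}]_+$, $[x]_+=\max(x,0)$. The diagram $\Gamma(B)$: vertices $1,\dots,n$, edge $i\to j$ iff $B_{i,j}>0$, weight $|B_{i,j}B_{j,i}|$; a diagram is any such $\Gamma(B)$, and $\mu_k(\Gamma(B))=\Gamma(\mu_k(B))$ (depends only on $\Gamma(B)$). A cycle is an induced subdiagram on $r\ge3$ vertices whose underlying graph is an $r$-cycle; oriented if cyclically oriented, non-oriented otherwise. -}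

module Defs where

open import Data.Nat as ℕ using (ℕ; zero; suc)
open import Data.Integer as ℤ using (ℤ; +_; -_; _*_; _+_; ∣_∣; sign)
open import Data.Fin using (Fin; zero; suc)
open import Data.Product using (Σ; Σ-syntax; ∃; ∃-syntax; _×_; _,_)
open import Data.Sum using (_⊎_)
open import Relation.Binary.PropositionalEquality using (_≡_)
open import Relation.Nullary using (¬_)
open import Function.Definitions using (Injective)
open import Function.Bundles using (_⇔_)

Matrix : ℕ → Set
Matrix n = Fin n → Fin n → ℤ

SkewSymmetrizable : ∀ {n} → Matrix n → Set
SkewSymmetrizable {n} B =
  Σ[ d ∈ (Fin n → ℕ) ] ((∀ i → 0 ℕ.< d i) ×
     (∀ i j → (+ d i) * B i j ≡ - ((+ d j) * B j i)))

pos : ℤ → ℤ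
pos x = x ℤ.⊔ + 0

sgn : ℤ → ℤ
sgn (+ zero) = + 0
sgn (+ suc _) = + 1
sgn ℤ.-[1+ _ ] = - (+ 1)

μ : ∀ {n} → Fin n → Matrix n → Matrix n
μ k B i j with i Data.Fin.≟ k | j Data.Fin.≟ k
... | Relation.Nullary.yes _ | _ = - B i j
... | Relation.Nullary.no _ | Relation.Nullary.yes _ = - B i j
... | Relation.Nullary.no _ | Relation.Nullary.no _ =
  B i j + sgn (B i k) * pos (B i k * B k j)

-- The diagram Γ(B): edge i → j iff B i j > 0, weight |B i j B j i|.
Edge : ∀ {n} → Matrix n → Fin n → Fin n → Set
Edge B i j = + 0 ℤ.< B i j

Adjacent : ∀ {n} → Matrix n → Fin n → Fin n → Set
Adjacent B i j = Edge B i j ⊎ Edge B j i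

weight : ∀ {n} → Matrix n → Fin n → Fin n → ℕ
weight B i j = ∣ B i j * B j i ∣

-- cyclic successor on Fin (suc m): i ↦ i+1 mod (suc m)
next : ∀ {m} → Fin (suc m) → Fin (suc m)
next {zero} zero = zero
next {suc m} zero = suc zero
next {suc m} (suc i) with next {m} i
... | zero = zero
... | suc j = suc (suc j)

-- A cycle of Γ(B): distinct vertices v 0, …, v m (r = m+1 ≥ 3 of them)
-- such that the induced subdiagram on them has as underlying graph the
-- r-cycle v 0 — v 1 — … — v m — v 0 (two of them are adjacent iff they are
-- cyclically consecutive).
record Cycle {n} (B : Matrix n) : Set where
  field
    m      : ℕ
    atLeast3 : 2 ℕ.≤ m
    v      : Fin (suc m) → Fin n
    v-inj  : Injective _≡_ _≡_ v
    induced : ∀ a b → Adjacent B (v a) (v b) ⇔ (b ≡ next a ⊎ a ≡ next b)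

  Oriented : Set
  Oriented = (∀ a → Edge B (v a) (v (next a))) ⊎ (∀ a → Edge B (v (next a)) (v a))

  NonOriented : Set
  NonOriented = ¬ Oriented

  _∈ᶜ : Fin n → Set
  k ∈ᶜ = ∃[ a ] v a ≡ k

open Cycle public

OnNonOrientedCycle : ∀ {n} → Matrix n → Fin n → Set
OnNonOrientedCycle B k = Σ[ C ∈ Cycle B ] (NonOriented C × (_∈ᶜ C k))

OnHeavyEdge : ∀ {n} → Matrix n → Fin n → Set
OnHeavyEdge B k = ∃[ j ] (4 ℕ.≤ weight B k j)

HasHeavyEdge : ∀ {n} → Matrix n → Set
HasHeavyEdge B = ∃[ i ] ∃[ j ] (4 ℕ.≤ weight B i j)

HasNonOrientedCycle : ∀ {n} → Matrix n → Set
HasNonOrientedCycle B = Σ[ C ∈ Cycle B ] NonOriented C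

module Submission where

-- Only the signs of B matter: B i j and B j i have opposite signs.  Mutation at k negates the
-- entries in row and column k, so weights at k are kept, and changes B i j (i, j ≠ k) only
-- along a path i → k → j, by adding B i k B k j in the direction i → j.  So suppose k lies on a
-- non-oriented cycle, rotated to start at k, with neighbours `before` and `after`.  If k is a
-- sink (or, reversing all arrows, a source) no other entry on the cycle changes and it stays
-- non-oriented.  If before → k → after (or the reverse) and the cycle is a triangle, non-orientedness
-- forces before → after, whose weight becomes at least 2 · 2.  On a longer cycle before and after
-- are not adjacent; mutation creates the chord before → after, and the cycle with k removed is an
-- induced cycle; it cannot run forwards, as the original cycle would, nor backwards, against the chord.

open import Defs
open import Data.Nat as ℕ using (ℕ; zero; suc; z≤n; s≤s; _≤_)
import Data.Nat.Properties as ℕP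
open import Data.Nat.GeneralisedArithmetic using (fold)
open import Data.Integer as ℤ using (ℤ; +_; -[1+_]; _+_; _*_; -_; ∣_∣; +<+; -<+; +≤+; -≤+)
import Data.Integer.Properties as ℤP
open import Data.Fin as F using (Fin; zero; suc; fromℕ; inject₁; toℕ)
import Data.Fin.Properties as FP
open import Data.Product as Product using (∃-syntax; _×_; _,_; proj₁)
open import Data.Sum as Sum using (_⊎_; inj₁; inj₂)
open import Data.Sum.Function.Propositional using (_⊎-⇔_)
open import Data.Empty using (⊥-elim)
open import Relation.Nullary using (¬_; yes; no)
open import Relation.Nullary.Decidable using (_×-dec_)
open import Relation.Binary.PropositionalEquality
open import Function using (_∘_)
open import Function.Bundles using (_⇔_; mk⇔; Equivalence)
open import Function.Definitions using (Injective)
import Function.Properties.Equivalence as ⇔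

⊎-swap⇔ : ∀ {A C : Set} → (A ⊎ C) ⇔ (C ⊎ A)
⊎-swap⇔ = mk⇔ Sum.swap Sum.swap

next-fromℕ : ∀ m → next (fromℕ m) ≡ zero
next-fromℕ zero = refl
next-fromℕ (suc m) with next (fromℕ m) | next-fromℕ m
... | .zero | refl = refl

next-inject₁ : ∀ m (c : Fin (suc m)) → next {suc m} (inject₁ c) ≡ suc c
next-inject₁ m zero = refl
next-inject₁ (suc m) (suc c) with next (inject₁ c) | next-inject₁ m c
... | .(suc c) | refl = refl

fromℕ⊎inject₁ : ∀ m (a : Fin (suc m)) → a ≡ fromℕ m ⊎ ∃[ c ] a ≡ inject₁ c
fromℕ⊎inject₁ zero zero = inj₁ refl
fromℕ⊎inject₁ (suc m) zero = inj₂ (zero , refl)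
fromℕ⊎inject₁ (suc m) (suc a) with fromℕ⊎inject₁ m a
... | inj₁ refl = inj₁ refl
... | inj₂ (c , refl) = inj₂ (suc c , refl)

next-injective : ∀ m → Injective _≡_ _≡_ (next {m})
next-injective zero {zero} {zero} _ = refl
next-injective (suc m) {a} {b} e with fromℕ⊎inject₁ (suc m) a | fromℕ⊎inject₁ (suc m) b
... | inj₁ refl | inj₁ refl = refl
... | inj₁ refl | inj₂ (d , refl)
  with () ← trans (sym (next-fromℕ (suc m))) (trans e (next-inject₁ m d))
... | inj₂ (c , refl) | inj₁ refl
  with () ← trans (sym (next-inject₁ m c)) (trans e (next-fromℕ (suc m)))
... | inj₂ (c , refl) | inj₂ (d , refl) =
  cong inject₁ (FP.suc-injective (trans (sym (next-inject₁ m c)) (trans e (next-inject₁ m d))))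

next-preimage : ∀ m (b : Fin (suc m)) → ∃[ a ] next a ≡ b
next-preimage zero zero = zero , refl
next-preimage (suc m) zero = fromℕ (suc m) , next-fromℕ (suc m)
next-preimage (suc m) (suc c) = inject₁ c , next-inject₁ m c

next-suc : ∀ m (c : Fin (suc m)) → c ≢ fromℕ m → next {suc m} (suc c) ≡ suc (next c)
next-suc m c c≢last with next c in eq
... | zero = ⊥-elim (c≢last (next-injective m (trans eq (sym (next-fromℕ m)))))
... | suc _ = refl

suc≡next-suc⇔≡next : ∀ m (c d : Fin (suc m)) → ¬ (c ≡ fromℕ m × d ≡ zero) →
                     (suc d ≡ next (suc c)) ⇔ (d ≡ next c)
suc≡next-suc⇔≡next m c d ¬wrap with c F.≟ fromℕ m
... | yes refl = mk⇔ (λ 1+d≡0 → ⊥-elim (FP.0≢1+n (trans (sym (next-fromℕ (suc m))) (sym 1+d≡0))))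
                     (λ d≡next → ⊥-elim (¬wrap (refl , trans d≡next (next-fromℕ m))))
... | no c≢last rewrite next-suc m c c≢last = mk⇔ FP.suc-injective (cong suc)

fold-next : ∀ {m} t (c : Fin (suc m)) → toℕ c ≡ t → fold zero next t ≡ c
fold-next zero zero _ = refl
fold-next {suc m} (suc t) (suc c) 1+c≡1+t =
  trans (cong next (fold-next t (inject₁ c) (trans (FP.toℕ-inject₁ c) (ℕP.suc-injective 1+c≡1+t))))
        (next-inject₁ m c)

data OppositeSigns : ℤ → ℤ → Set where
  zero-zero : ∀ {a b} → a ≡ + 0 → b ≡ + 0 → OppositeSigns a b
  pos-neg : ∀ {a b} → + 0 ℤ.< a → b ℤ.< + 0 → OppositeSigns a b
  neg-pos : ∀ {a b} → a ℤ.< + 0 → + 0 ℤ.< b → OppositeSigns a b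

OppositeSigns⇒*≤0 : ∀ {a b} → OppositeSigns a b → a * b ℤ.≤ + 0
OppositeSigns⇒*≤0 (zero-zero refl refl) = +≤+ z≤n
OppositeSigns⇒*≤0 {+ suc _} { -[1+ _ ]} (pos-neg _ _) = -≤+
OppositeSigns⇒*≤0 { -[1+ _ ]} {+ suc _} (neg-pos _ _) = -≤+
OppositeSigns⇒*≤0 {+ zero} (pos-neg (+<+ ()) _)
OppositeSigns⇒*≤0 {+ suc _} {+ _} (pos-neg _ (+<+ ()))
OppositeSigns⇒*≤0 { -[1+ _ ]} (pos-neg () _)
OppositeSigns⇒*≤0 {+ _} (neg-pos (+<+ ()) _)
OppositeSigns⇒*≤0 { -[1+ _ ]} {+ zero} (neg-pos _ (+<+ ()))
OppositeSigns⇒*≤0 { -[1+ _ ]} { -[1+ _ ]} (neg-pos _ ())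

weighted-skew⇒OppositeSigns : ∀ p q a b → + suc p * a ≡ - (+ suc q * b) → OppositeSigns a b
weighted-skew⇒OppositeSigns p q (+ zero) (+ zero) _ = zero-zero refl refl
weighted-skew⇒OppositeSigns p q (+ zero) (+ suc b) e with () ← trans (sym (ℤP.*-zeroʳ (+ suc p))) e
weighted-skew⇒OppositeSigns p q (+ zero) -[1+ b ] e with () ← trans (sym (ℤP.*-zeroʳ (+ suc p))) e
weighted-skew⇒OppositeSigns p q (+ suc a) (+ zero) e with () ← trans e (cong -_ (ℤP.*-zeroʳ (+ suc q)))
weighted-skew⇒OppositeSigns p q -[1+ a ] (+ zero) e with () ← trans e (cong -_ (ℤP.*-zeroʳ (+ suc q)))
weighted-skew⇒OppositeSigns p q (+ suc a) -[1+ b ] _ = pos-neg (+<+ (s≤s z≤n)) -<+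
weighted-skew⇒OppositeSigns p q -[1+ a ] (+ suc b) _ = neg-pos -<+ (+<+ (s≤s z≤n))

pos-nonPos : ∀ {z} → z ℤ.≤ + 0 → pos z ≡ + 0
pos-nonPos {+ zero} _ = refl
pos-nonPos { -[1+ _ ]} _ = refl
pos-nonPos {+ suc _} (+≤+ ())

*≰0⇒sgn≡ : ∀ p q → ¬ p * q ℤ.≤ + 0 → sgn p ≡ sgn q
*≰0⇒sgn≡ (+ zero) q pq≰0 = ⊥-elim (pq≰0 (ℤP.≤-reflexive (ℤP.*-zeroˡ q)))
*≰0⇒sgn≡ p (+ zero) pq≰0 = ⊥-elim (pq≰0 (ℤP.≤-reflexive (ℤP.*-zeroʳ p)))
*≰0⇒sgn≡ (+ suc _) (+ suc _) _ = refl
*≰0⇒sgn≡ -[1+ _ ] -[1+ _ ] _ = refl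
*≰0⇒sgn≡ (+ suc _) -[1+ _ ] pq≰0 = ⊥-elim (pq≰0 -≤+)
*≰0⇒sgn≡ -[1+ _ ] (+ suc _) pq≰0 = ⊥-elim (pq≰0 -≤+)

sgn*pos-comm : ∀ p q → sgn p * pos (p * q) ≡ sgn q * pos (q * p)
sgn*pos-comm p q rewrite ℤP.*-comm q p with p * q ℤ.≤? + 0
... | yes pq≤0 rewrite pos-nonPos pq≤0 = trans (ℤP.*-zeroʳ (sgn p)) (sym (ℤP.*-zeroʳ (sgn q)))
... | no pq≰0 = cong (_* pos (p * q)) (*≰0⇒sgn≡ p q pq≰0)

mutated : ℤ → ℤ → ℤ → ℤ
mutated x p q = x + sgn p * pos (p * q)

mutated-unchanged : ∀ x p q → p * q ℤ.≤ + 0 → mutated x p q ≡ x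
mutated-unchanged x p q pq≤0 = begin
  x + sgn p * pos (p * q) ≡⟨ cong (λ t → x + sgn p * t) (pos-nonPos pq≤0) ⟩
  x + sgn p * + 0         ≡⟨ cong (ℤ._+_ x) (ℤP.*-zeroʳ (sgn p)) ⟩
  x + + 0                 ≡⟨ ℤP.+-identityʳ x ⟩
  x                       ∎
  where open ≡-Reasoning

mutated-grows-pos : ∀ {x p q} → + 0 ℤ.< x → + 0 ℤ.< p → + 0 ℤ.< q → 2 ≤ ∣ mutated x p q ∣
mutated-grows-pos (+<+ (s≤s z≤n)) (+<+ (s≤s z≤n)) (+<+ (s≤s z≤n)) = s≤s (ℕP.≤-trans (s≤s z≤n) (ℕP.m≤n+m _ _))

mutated-grows-neg : ∀ {x p q} → x ℤ.< + 0 → p ℤ.< + 0 → q ℤ.< + 0 → 2 ≤ ∣ mutated x p q ∣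
mutated-grows-neg -<+ -<+ -<+ = s≤s (s≤s z≤n)

mutated-creates-pos : ∀ {p q} → + 0 ℤ.< p → + 0 ℤ.< q → + 0 ℤ.< mutated (+ 0) p q
mutated-creates-pos (+<+ (s≤s z≤n)) (+<+ (s≤s z≤n)) = +<+ (s≤s z≤n)

mutated-creates-neg : ∀ {p q} → p ℤ.< + 0 → q ℤ.< + 0 → mutated (+ 0) p q ℤ.< + 0
mutated-creates-neg -<+ -<+ = -<+

SignSkewSymmetric : ∀ {n} → Matrix n → Set
SignSkewSymmetric B = ∀ i j → OppositeSigns (B i j) (B j i)

skewSymmetrizable⇒signSkewSymmetric : ∀ {n} {B : Matrix n} → SkewSymmetrizable B → SignSkewSymmetric B
skewSymmetrizable⇒signSkewSymmetric {B = B} (d , d>0 , skew) i j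
  with d i | d>0 i | d j | d>0 j | skew i j
... | suc p | _ | suc q | _ | dB≡-dBᵀ = weighted-skew⇒OppositeSigns p q (B i j) (B j i) dB≡-dBᵀ

_ᵀ : ∀ {n} → Matrix n → Matrix n
(B ᵀ) i j = B j i

signSkew-ᵀ : ∀ {n} {B : Matrix n} → SignSkewSymmetric B → SignSkewSymmetric (B ᵀ)
signSkew-ᵀ ss i j = ss j i

module _ {n} (B : Matrix n) (k : Fin n) where

  μ-row : ∀ j → μ k B k j ≡ - B k j
  μ-row j with k F.≟ k
  ... | yes _ = refl
  ... | no k≢k = ⊥-elim (k≢k refl)

  μ-col : ∀ i → μ k B i k ≡ - B i k
  μ-col i with i F.≟ k | k F.≟ k
  ... | yes _ | _ = refl
  ... | no _ | yes _ = refl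
  ... | no _ | no k≢k = ⊥-elim (k≢k refl)

  μ-off : ∀ {i j} → i ≢ k → j ≢ k → μ k B i j ≡ mutated (B i j) (B i k) (B k j)
  μ-off {i} {j} i≢k j≢k with i F.≟ k | j F.≟ k
  ... | yes i≡k | _ = ⊥-elim (i≢k i≡k)
  ... | no _ | yes j≡k = ⊥-elim (j≢k j≡k)
  ... | no _ | no _ = refl

  μ-unchanged : ∀ {i j} → i ≢ k → j ≢ k → B i k * B k j ℤ.≤ + 0 → μ k B i j ≡ B i j
  μ-unchanged {i} {j} i≢k j≢k ≤0 = trans (μ-off i≢k j≢k) (mutated-unchanged (B i j) (B i k) (B k j) ≤0)

  μ-ᵀ : ∀ i j → μ k (B ᵀ) i j ≡ μ k B j i
  μ-ᵀ i j with i F.≟ k | j F.≟ k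
  ... | yes _ | yes _ = refl
  ... | yes _ | no _ = refl
  ... | no _ | yes _ = refl
  ... | no _ | no _ = cong (ℤ._+_ (B j i)) (sgn*pos-comm (B k i) (B j k))

  weight-μ-row : ∀ j → weight (μ k B) k j ≡ weight B k j
  weight-μ-row j = begin
    ∣ μ k B k j * μ k B j k ∣       ≡⟨ cong₂ (λ x y → ∣ x * y ∣) (μ-row j) (μ-col j) ⟩
    ∣ - B k j * - B j k ∣           ≡⟨ ℤP.abs-* (- B k j) (- B j k) ⟩
    ∣ - B k j ∣ ℕ.* ∣ - B j k ∣     ≡⟨ cong₂ ℕ._*_ (ℤP.∣-i∣≡∣i∣ (B k j)) (ℤP.∣-i∣≡∣i∣ (B j k)) ⟩
    ∣ B k j ∣ ℕ.* ∣ B j k ∣         ≡⟨ ℤP.abs-* (B k j) (B j k) ⟨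
    ∣ B k j * B j k ∣               ∎
    where open ≡-Reasoning

module SignSkew {n} {B : Matrix n} (ss : SignSkewSymmetric B) where

  edge⇒reverse<0 : ∀ {i j} → Edge B i j → B j i ℤ.< + 0
  edge⇒reverse<0 {i} {j} i→j with ss i j
  ... | zero-zero Bij≡0 _ = ⊥-elim (ℤP.<-irrefl (sym Bij≡0) i→j)
  ... | pos-neg _ Bji<0 = Bji<0
  ... | neg-pos Bij<0 _ = ⊥-elim (ℤP.<-asym i→j Bij<0)

  <0⇒reverse-edge : ∀ {i j} → B i j ℤ.< + 0 → Edge B j i
  <0⇒reverse-edge {i} {j} Bij<0 with ss i j
  ... | zero-zero Bij≡0 _ = ⊥-elim (ℤP.<-irrefl Bij≡0 Bij<0)
  ... | pos-neg Bij>0 _ = ⊥-elim (ℤP.<-asym Bij<0 Bij>0)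
  ... | neg-pos _ j→i = j→i

  edge-asym : ∀ {i j} → Edge B i j → ¬ Edge B j i
  edge-asym i→j j→i = ℤP.<-asym i→j (edge⇒reverse<0 j→i)

  zero⊎adjacent : ∀ i j → B i j ≡ + 0 ⊎ Adjacent B i j
  zero⊎adjacent i j with ss i j
  ... | zero-zero Bij≡0 _ = inj₁ Bij≡0
  ... | pos-neg i→j _ = inj₂ (inj₁ i→j)
  ... | neg-pos _ j→i = inj₂ (inj₂ j→i)

  ¬adjacent⇒zero : ∀ {i j} → ¬ Adjacent B i j → B i j ≡ + 0
  ¬adjacent⇒zero {i} {j} ¬adj = Sum.[ (λ Bij≡0 → Bij≡0) , (λ adj → ⊥-elim (¬adj adj)) ] (zero⊎adjacent i j)

  module _ (k : Fin n) where

    μ-edge-out : ∀ {j} → Edge (μ k B) k j ⇔ Edge B j k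
    μ-edge-out {j} = mk⇔
      (λ k→j → <0⇒reverse-edge (ℤP.neg-cancel-< {+ 0} (subst (+ 0 ℤ.<_) (μ-row B k j) k→j)))
      (λ j→k → subst (+ 0 ℤ.<_) (sym (μ-row B k j)) (ℤP.neg-mono-< (edge⇒reverse<0 j→k)))

    μ-edge-in : ∀ {i} → Edge (μ k B) i k ⇔ Edge B k i
    μ-edge-in {i} = mk⇔
      (λ i→k → <0⇒reverse-edge (ℤP.neg-cancel-< {+ 0} (subst (+ 0 ℤ.<_) (μ-col B k i) i→k)))
      (λ k→i → subst (+ 0 ℤ.<_) (sym (μ-col B k i)) (ℤP.neg-mono-< (edge⇒reverse<0 k→i)))

    μ-adjacent-out : ∀ {j} → Adjacent (μ k B) k j ⇔ Adjacent B k j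
    μ-adjacent-out {j} = ⇔.trans (μ-edge-out ⊎-⇔ μ-edge-in {j}) ⊎-swap⇔

    μ-adjacent-in : ∀ {i} → Adjacent (μ k B) i k ⇔ Adjacent B i k
    μ-adjacent-in = ⇔.trans ⊎-swap⇔ (⇔.trans μ-adjacent-out ⊎-swap⇔)

    μ-transitive-triangle : ∀ {i j} → i ≢ k → j ≢ k → Edge B i k → Edge B k j → Edge B i j →
                            4 ≤ weight (μ k B) i j
    μ-transitive-triangle {i} {j} i≢k j≢k i→k k→j i→j = begin
      4                                                          ≤⟨ ℕP.*-mono-≤ grown-ij grown-ji ⟩
      ∣ mutated (B i j) (B i k) (B k j) ∣ ℕ.* ∣ mutated (B j i) (B j k) (B k i) ∣
        ≡⟨ ℤP.abs-* (mutated (B i j) (B i k) (B k j)) (mutated (B j i) (B j k) (B k i)) ⟨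
      ∣ mutated (B i j) (B i k) (B k j) * mutated (B j i) (B j k) (B k i) ∣
        ≡⟨ cong₂ (λ x y → ∣ x * y ∣) (μ-off B k i≢k j≢k) (μ-off B k j≢k i≢k) ⟨
      weight (μ k B) i j                                         ∎
      where
      open ℕP.≤-Reasoning
      grown-ij = mutated-grows-pos i→j i→k k→j
      grown-ji = mutated-grows-neg (edge⇒reverse<0 i→j) (edge⇒reverse<0 k→j) (edge⇒reverse<0 i→k)

IsInducedCycle : ∀ {n m} → Matrix n → (Fin (suc m) → Fin n) → Set
IsInducedCycle B w = ∀ a b → Adjacent B (w a) (w b) ⇔ (b ≡ next a ⊎ a ≡ next b)

inducedCycle-ᵀ : ∀ {n m} {B : Matrix n} {w : Fin (suc m) → Fin n} → IsInducedCycle B w → IsInducedCycle (B ᵀ) w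
inducedCycle-ᵀ w-cycle a b = ⇔.trans ⊎-swap⇔ (w-cycle a b)

OrientedAlong : ∀ {n m} → Matrix n → (Fin (suc m) → Fin n) → Set
OrientedAlong B w = (∀ a → Edge B (w a) (w (next a))) ⊎ (∀ a → Edge B (w (next a)) (w a))

inducedCycle : ∀ {n M} {B : Matrix n} (w : Fin (3 ℕ.+ M) → Fin n) →
               Injective _≡_ _≡_ w → IsInducedCycle B w → Cycle B
inducedCycle {M = M} w w-inj w-cycle = record
  { m = 2 ℕ.+ M ; atLeast3 = s≤s (s≤s z≤n) ; v = w ; v-inj = w-inj ; induced = w-cycle }

adjacent-cong : ∀ {n} {M N : Matrix n} {i j} → M i j ≡ N i j → M j i ≡ N j i → Adjacent M i j ⇔ Adjacent N i j
adjacent-cong Mij≡Nij Mji≡Nji = edge-cong Mij≡Nij ⊎-⇔ edge-cong Mji≡Nji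
  where
  edge-cong : ∀ {x y} → x ≡ y → (+ 0 ℤ.< x) ⇔ (+ 0 ℤ.< y)
  edge-cong refl = ⇔.refl

HeavyOrNonOriented : ∀ {n} → Matrix n → Set
HeavyOrNonOriented M = HasHeavyEdge M ⊎ HasNonOrientedCycle M

module Reversal {n} {M N : Matrix n} (N≡Mᵀ : ∀ i j → N i j ≡ M j i) where

  edge-reversed : ∀ {i j} → Edge N i j ⇔ Edge M j i
  edge-reversed {i} {j} = mk⇔ (subst (+ 0 ℤ.<_) (N≡Mᵀ i j)) (subst (+ 0 ℤ.<_) (sym (N≡Mᵀ i j)))

  adjacent-reversed : ∀ {i j} → Adjacent N i j ⇔ Adjacent M i j
  adjacent-reversed {i} {j} = ⇔.trans (edge-reversed ⊎-⇔ edge-reversed {j} {i}) ⊎-swap⇔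

  cycle-reversed : Cycle N → Cycle M
  cycle-reversed C = record
    { m = m C ; atLeast3 = atLeast3 C ; v = v C ; v-inj = v-inj C
    ; induced = λ a b → ⇔.trans (⇔.sym adjacent-reversed) (induced C a b) }

  nonOriented-reversed : (C : Cycle N) → NonOriented C → NonOriented (cycle-reversed C)
  nonOriented-reversed C ¬oriented (inj₁ forward) = ¬oriented (inj₂ (Equivalence.from edge-reversed ∘ forward))
  nonOriented-reversed C ¬oriented (inj₂ backward) = ¬oriented (inj₁ (Equivalence.from edge-reversed ∘ backward))

  weight-reversed : ∀ i j → weight N i j ≡ weight M j i
  weight-reversed i j = cong ∣_∣ (cong₂ _*_ (N≡Mᵀ i j) (N≡Mᵀ j i))

  heavyOrNonOriented-reversed : HeavyOrNonOriented N → HeavyOrNonOriented M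
  heavyOrNonOriented-reversed (inj₁ (i , j , heavy)) = inj₁ (j , i , subst (4 ≤_) (weight-reversed i j) heavy)
  heavyOrNonOriented-reversed (inj₂ (C , ¬oriented)) = inj₂ (cycle-reversed C , nonOriented-reversed C ¬oriented)

module Rotation {n} {B : Matrix n} where

  rotate : Cycle B → Cycle B
  rotate C = record
    { m = m C ; atLeast3 = atLeast3 C ; v = v C ∘ next
    ; v-inj = next-injective (m C) ∘ v-inj C
    ; induced = λ a b → ⇔.trans (induced C (next a) (next b)) (next≡next⇔≡ ⊎-⇔ next≡next⇔≡) }
    where
    next≡next⇔≡ : ∀ {a b} → (next a ≡ next b) ⇔ (a ≡ b)
    next≡next⇔≡ = mk⇔ (next-injective (m C)) (cong next)

  rotate-nonOriented : (C : Cycle B) → NonOriented C → NonOriented (rotate C)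
  rotate-nonOriented C ¬oriented (inj₁ forward) = ¬oriented (inj₁ λ b →
    let a , next-a≡b = next-preimage (m C) b in subst (λ x → Edge B (v C x) (v C (next x))) next-a≡b (forward a))
  rotate-nonOriented C ¬oriented (inj₂ backward) = ¬oriented (inj₂ λ b →
    let a , next-a≡b = next-preimage (m C) b in subst (λ x → Edge B (v C (next x)) (v C x)) next-a≡b (backward a))

  rotateⁿ : ℕ → Cycle B → Cycle B
  rotateⁿ zero C = C
  rotateⁿ (suc t) C = rotateⁿ t (rotate C)

  rotateⁿ-nonOriented : ∀ t (C : Cycle B) → NonOriented C → NonOriented (rotateⁿ t C)
  rotateⁿ-nonOriented zero C ¬oriented = ¬oriented
  rotateⁿ-nonOriented (suc t) C ¬oriented = rotateⁿ-nonOriented t (rotate C) (rotate-nonOriented C ¬oriented)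

  rotateⁿ-start : ∀ t (C : Cycle B) → v (rotateⁿ t C) zero ≡ v C (fold zero next t)
  rotateⁿ-start zero C = refl
  rotateⁿ-start (suc t) C = rotateⁿ-start t (rotate C)

  rotate-to : (C : Cycle B) → NonOriented C → ∀ a → ∃[ C′ ] NonOriented C′ × v C′ zero ≡ v C a
  rotate-to C ¬oriented a =
    rotateⁿ (toℕ a) C , rotateⁿ-nonOriented (toℕ a) C ¬oriented ,
    trans (rotateⁿ-start (toℕ a) C) (cong (v C) (fold-next (toℕ a) a refl))

module Bypass {n} {B N : Matrix n} {m} (w : Fin (2 ℕ.+ m) → Fin n) (w-cycle : IsInducedCycle B w)
  (chord : Adjacent N (w (fromℕ (suc m))) (w (suc zero)))
  (agree : ∀ c d → ¬ (c ≡ fromℕ m × d ≡ zero) → ¬ (c ≡ zero × d ≡ fromℕ m) →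
           N (w (suc c)) (w (suc d)) ≡ B (w (suc c)) (w (suc d))) where

  bypass-induced : IsInducedCycle N (w ∘ suc)
  bypass-induced c d with c F.≟ fromℕ m ×-dec d F.≟ zero | c F.≟ zero ×-dec d F.≟ fromℕ m
  ... | yes (refl , refl) | _ = mk⇔ (λ _ → inj₁ (sym (next-fromℕ m))) (λ _ → chord)
  ... | no _ | yes (refl , refl) = mk⇔ (λ _ → inj₂ (sym (next-fromℕ m))) (λ _ → Sum.swap chord)
  ... | no ¬cd | no ¬dc = ⇔.trans unchanged (⇔.trans (w-cycle (suc c) (suc d)) shifted)
    where
    ¬dc′ = ¬dc ∘ Product.swap
    ¬cd′ = ¬cd ∘ Product.swap
    unchanged = adjacent-cong {M = N} {N = B} (agree c d ¬cd ¬dc) (agree d c ¬dc′ ¬cd′)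
    shifted = suc≡next-suc⇔≡next m c d ¬cd ⊎-⇔ suc≡next-suc⇔≡next m d c ¬dc′

module CycleStart {n} {B : Matrix n} (ss : SignSkewSymmetric B) {M : ℕ}
  (w : Fin (3 ℕ.+ M) → Fin n) (w-inj : Injective _≡_ _≡_ w) (w-cycle : IsInducedCycle B w) where

  open SignSkew ss

  k : Fin n
  k = w zero

  before after : Fin (3 ℕ.+ M)
  before = fromℕ (2 ℕ.+ M)
  after = suc zero

  next-before : next before ≡ zero
  next-before = next-fromℕ (2 ℕ.+ M)

  ≢k : ∀ {a} → a ≢ zero → w a ≢ k
  ≢k a≢0 = a≢0 ∘ w-inj

  neighbour-of-k : ∀ {a} → Adjacent B (w a) k → a ≡ before ⊎ a ≡ after
  neighbour-of-k {a} a~k with Equivalence.to (w-cycle a zero) a~k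
  ... | inj₁ 0≡next-a = inj₁ (next-injective (2 ℕ.+ M) (trans (sym 0≡next-a) (sym next-before)))
  ... | inj₂ a≡next-0 = inj₂ a≡next-0

  before~k : Adjacent B (w before) k
  before~k = Equivalence.from (w-cycle before zero) (inj₁ (sym next-before))

  k~after : Adjacent B k (w after)
  k~after = Equivalence.from (w-cycle zero after) (inj₁ refl)

  Chord : Fin (3 ℕ.+ M) → Fin (3 ℕ.+ M) → Set
  Chord a b = (a ≡ before × b ≡ after) ⊎ (a ≡ after × b ≡ before)

  *≤0⊎chord : ∀ a b → B (w a) k * B k (w b) ℤ.≤ + 0 ⊎ Chord a b
  *≤0⊎chord a b with zero⊎adjacent (w a) k | zero⊎adjacent k (w b)
  ... | inj₁ Bak≡0 | _ = inj₁ (ℤP.≤-reflexive (trans (cong (_* B k (w b)) Bak≡0) (ℤP.*-zeroˡ (B k (w b)))))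
  ... | inj₂ _ | inj₁ Bkb≡0 = inj₁ (ℤP.≤-reflexive (trans (cong (B (w a) k *_) Bkb≡0) (ℤP.*-zeroʳ (B (w a) k))))
  ... | inj₂ a~k | inj₂ k~b with neighbour-of-k a~k | neighbour-of-k (Sum.swap k~b)
  ...   | inj₁ refl | inj₁ refl = inj₁ (OppositeSigns⇒*≤0 (ss (w before) k))
  ...   | inj₂ refl | inj₂ refl = inj₁ (OppositeSigns⇒*≤0 (ss (w after) k))
  ...   | inj₁ refl | inj₂ refl = inj₂ (inj₁ (refl , refl))
  ...   | inj₂ refl | inj₁ refl = inj₂ (inj₂ (refl , refl))

  μ-off-chord : ∀ {a b} → a ≢ zero → b ≢ zero → ¬ Chord a b → μ k B (w a) (w b) ≡ B (w a) (w b)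
  μ-off-chord {a} {b} a≢0 b≢0 ¬chord with *≤0⊎chord a b
  ... | inj₁ ≤0 = μ-unchanged B k (≢k a≢0) (≢k b≢0) ≤0
  ... | inj₂ chord = ⊥-elim (¬chord chord)

  -- At a sink k the whole cycle survives, with k turned into a source.
  μ-sink : Edge B (w before) k → Edge B (w after) k → HasNonOrientedCycle (μ k B)
  μ-sink before→k after→k = inducedCycle w w-inj (λ a b → ⇔.trans (adjacent-μ a b) (w-cycle a b)) , ¬oriented
    where
    *≤0 : ∀ a b → B (w a) k * B k (w b) ℤ.≤ + 0
    *≤0 a b with *≤0⊎chord a b
    ... | inj₁ ≤0 = ≤0
    ... | inj₂ (inj₁ (refl , refl)) = OppositeSigns⇒*≤0 (pos-neg before→k (edge⇒reverse<0 after→k))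
    ... | inj₂ (inj₂ (refl , refl)) = OppositeSigns⇒*≤0 (pos-neg after→k (edge⇒reverse<0 before→k))

    adjacent-μ : ∀ a b → Adjacent (μ k B) (w a) (w b) ⇔ Adjacent B (w a) (w b)
    adjacent-μ zero b = μ-adjacent-out k
    adjacent-μ (suc a) zero = μ-adjacent-in k
    adjacent-μ (suc a) (suc b) = adjacent-cong {M = μ k B} {N = B}
      (μ-unchanged B k (≢k λ ()) (≢k λ ()) (*≤0 (suc a) (suc b)))
      (μ-unchanged B k (≢k λ ()) (≢k λ ()) (*≤0 (suc b) (suc a)))

    ¬oriented : ¬ OrientedAlong (μ k B) w
    ¬oriented (inj₁ forward) =
      edge-asym before→k (Equivalence.to (μ-edge-in k) (subst (λ x → Edge (μ k B) (w before) (w x)) next-before (forward before)))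
    ¬oriented (inj₂ backward) = edge-asym after→k (Equivalence.to (μ-edge-in k) (backward zero))

μ-triangle-path : ∀ {n} {B : Matrix n} (ss : SignSkewSymmetric B) (w : Fin 3 → Fin n) →
  Injective _≡_ _≡_ w → IsInducedCycle B w → ¬ OrientedAlong B w →
  Edge B (w (suc (suc zero))) (w zero) → Edge B (w zero) (w (suc zero)) → HasHeavyEdge (μ (w zero) B)
μ-triangle-path {B = B} ss w w-inj w-cycle ¬oriented 2→0 0→1
  with Equivalence.from (w-cycle (suc zero) (suc (suc zero))) (inj₁ refl)
... | inj₁ 1→2 = ⊥-elim (¬oriented (inj₁ λ { zero → 0→1 ; (suc zero) → 1→2 ; (suc (suc zero)) → 2→0 }))
... | inj₂ 2→1 = w (suc (suc zero)) , w (suc zero) ,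
  SignSkew.μ-transitive-triangle ss (w zero) ((λ ()) ∘ w-inj) ((λ ()) ∘ w-inj) 2→0 0→1 2→1

module _ {n} {B : Matrix n} (ss : SignSkewSymmetric B) {M : ℕ}
  (w : Fin (4 ℕ.+ M) → Fin n) (w-inj : Injective _≡_ _≡_ w) (w-cycle : IsInducedCycle B w) where

  open SignSkew ss
  open CycleStart ss w w-inj w-cycle

  μ-long-cycle-path : ¬ OrientedAlong B w → Edge B (w before) k → Edge B k (w after) → HasNonOrientedCycle (μ k B)
  μ-long-cycle-path ¬oriented before→k k→after = inducedCycle (w ∘ suc) (FP.suc-injective ∘ w-inj) bypass-induced , ¬oriented′
    where
    N : Matrix n
    N = μ k B

    before≁after : ¬ Adjacent B (w before) (w after)
    before≁after adj with Equivalence.to (w-cycle before after) adj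
    ... | inj₁ after≡next-before with () ← trans after≡next-before next-before
    ... | inj₂ ()

    μ-nonadjacent : ∀ {a b} → a ≢ zero → b ≢ zero → ¬ Adjacent B (w a) (w b) →
                    N (w a) (w b) ≡ mutated (+ 0) (B (w a) k) (B k (w b))
    μ-nonadjacent {a} {b} a≢0 b≢0 a≁b =
      trans (μ-off B k (≢k a≢0) (≢k b≢0)) (cong (λ x → mutated x (B (w a) k) (B k (w b))) (¬adjacent⇒zero a≁b))

    chord : Edge N (w before) (w after)
    chord = subst (+ 0 ℤ.<_) (sym (μ-nonadjacent (λ ()) (λ ()) before≁after))
                  (mutated-creates-pos before→k k→after)

    chord-reverse<0 : N (w after) (w before) ℤ.< + 0
    chord-reverse<0 = subst (ℤ._< + 0) (sym (μ-nonadjacent (λ ()) (λ ()) (before≁after ∘ Sum.swap)))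
                            (mutated-creates-neg (edge⇒reverse<0 k→after) (edge⇒reverse<0 before→k))

    agree : ∀ c d → ¬ (c ≡ fromℕ (2 ℕ.+ M) × d ≡ zero) → ¬ (c ≡ zero × d ≡ fromℕ (2 ℕ.+ M)) →
            N (w (suc c)) (w (suc d)) ≡ B (w (suc c)) (w (suc d))
    agree c d ¬wrap ¬wrap′ = μ-off-chord (λ ()) (λ ()) λ
      { (inj₁ (1+c≡before , 1+d≡after)) → ¬wrap (FP.suc-injective 1+c≡before , FP.suc-injective 1+d≡after)
      ; (inj₂ (1+c≡after , 1+d≡before)) → ¬wrap′ (FP.suc-injective 1+c≡after , FP.suc-injective 1+d≡before) }

    open Bypass {B = B} {N = N} w w-cycle (inj₁ chord) agree

    ¬oriented′ : ¬ OrientedAlong N (w ∘ suc)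
    ¬oriented′ (inj₁ forward) = ¬oriented (inj₁ forward-B)
      where
      forward-B : ∀ a → Edge B (w a) (w (next a))
      forward-B zero = k→after
      forward-B (suc c) with c F.≟ fromℕ (2 ℕ.+ M)
      ... | yes refl = subst (λ x → Edge B (w before) (w x)) (sym next-before) before→k
      ... | no c≢last rewrite next-suc (2 ℕ.+ M) c c≢last =
        subst (+ 0 ℤ.<_) (agree c (next c) (c≢last ∘ proj₁) λ { (refl , ()) }) (forward c)
    ¬oriented′ (inj₂ backward) =
      ℤP.<-asym chord-reverse<0 (subst (λ x → Edge N (w (suc x)) (w before)) (next-fromℕ (2 ℕ.+ M)) (backward (fromℕ (2 ℕ.+ M))))

μ-cycle-path : ∀ {n} {B : Matrix n} (ss : SignSkewSymmetric B) {M} (w : Fin (3 ℕ.+ M) → Fin n) →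
  Injective _≡_ _≡_ w → IsInducedCycle B w → ¬ OrientedAlong B w →
  Edge B (w (fromℕ (2 ℕ.+ M))) (w zero) → Edge B (w zero) (w (suc zero)) → HeavyOrNonOriented (μ (w zero) B)
μ-cycle-path ss {zero} w w-inj w-cycle ¬oriented before→k k→after =
  inj₁ (μ-triangle-path ss w w-inj w-cycle ¬oriented before→k k→after)
μ-cycle-path ss {suc M} w w-inj w-cycle ¬oriented before→k k→after =
  inj₂ (μ-long-cycle-path ss w w-inj w-cycle ¬oriented before→k k→after)

module _ {n} {B : Matrix n} (ss : SignSkewSymmetric B) {M} (w : Fin (3 ℕ.+ M) → Fin n)
  (w-inj : Injective _≡_ _≡_ w) (w-cycle : IsInducedCycle B w) where

  open CycleStart ss w w-inj w-cycle using (before~k; k~after; μ-sink)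

  private
    w-cycleᵀ : IsInducedCycle (B ᵀ) w
    w-cycleᵀ = inducedCycle-ᵀ {B = B} w-cycle

    reversed : HeavyOrNonOriented (μ (w zero) (B ᵀ)) → HeavyOrNonOriented (μ (w zero) B)
    reversed = Reversal.heavyOrNonOriented-reversed (μ-ᵀ B (w zero))

  -- Transposing B reverses every arrow, turning a source into a sink and a backward path into a forward one.
  μ-inducedCycle-start : ¬ OrientedAlong B w → HeavyOrNonOriented (μ (w zero) B)
  μ-inducedCycle-start ¬oriented with before~k | k~after
  ... | inj₁ before→k | inj₁ k→after = μ-cycle-path ss w w-inj w-cycle ¬oriented before→k k→after
  ... | inj₁ before→k | inj₂ after→k = inj₂ (μ-sink before→k after→k)
  ... | inj₂ k→before | inj₂ after→k =
    reversed (μ-cycle-path (signSkew-ᵀ ss) w w-inj w-cycleᵀ (¬oriented ∘ Sum.swap) k→before after→k)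
  ... | inj₂ k→before | inj₁ k→after =
    reversed (inj₂ (CycleStart.μ-sink (signSkew-ᵀ ss) w w-inj w-cycleᵀ k→before k→after))

μ-nonOrientedCycle-start : ∀ {n} {B : Matrix n} → SignSkewSymmetric B →
  (C : Cycle B) → NonOriented C → HeavyOrNonOriented (μ (v C zero) B)
μ-nonOrientedCycle-start ss record { m = suc (suc M) ; v = w ; v-inj = w-inj ; induced = w-cycle } =
  μ-inducedCycle-start ss w w-inj w-cycle
μ-nonOrientedCycle-start ss record { m = suc zero ; atLeast3 = s≤s () }

lemma4p5 : (n : ℕ) → 3 ≤ n → (B : Matrix n) → SkewSymmetrizable B →
           (k : Fin n) →
           OnNonOrientedCycle B k ⊎ OnHeavyEdge B k →
           HasHeavyEdge (μ k B) ⊎ HasNonOrientedCycle (μ k B)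
lemma4p5 n _ B skew k (inj₂ (j , heavy)) = inj₁ (k , j , subst (4 ≤_) (sym (weight-μ-row B k j)) heavy)
lemma4p5 n _ B skew k (inj₁ (C , ¬oriented , a , va≡k))
  with C′ , ¬oriented′ , start≡va ← Rotation.rotate-to C ¬oriented a =
  subst (λ x → HeavyOrNonOriented (μ x B)) (trans start≡va va≡k)
        (μ-nonOrientedCycle-start (skewSymmetrizable⇒signSkewSymmetric skew) C′ ¬oriented′)
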